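{- There exists a family $(S_t)_{t \ge 2}$ of finite sets of words over $\{{\tt 0},{\tt 1}\}$, where $S_t$ consists of $t+1$ words each of length at most $t+1$, such that $\mathrm{sc}(S_t^*) = 2^{\Omega(t)}$. Moreover, if $m_t$ denotes the total number of symbols in the words of $S_t$, then $\mathrm{sc}(S_t^*) = 2^{\Omega(\sqrt{m_t})}$.
   Context: For a regular language $L$ over $\{{\tt 0},{\tt 1}\}$, $\mathrm{sc}(L)$ is the number of states of the minimal (complete) DFA accepting $L$. -}

module Defs where

open import Data.Bool using (Bool; true; false)
open import Data.Nat using (ℕ; zero; suc; _+_; _*_; _^_; _≤_)
open import Data.Fin using (Fin)
open import Data.List using (List; []; _∷_; _++_; length; map)
open import Data.Nat.ListAction using (sum)
open import Data.List.Membership.Propositional using (_∈_)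
open import Relation.Binary.PropositionalEquality using (_≡_)
open import Function.Bundles using (_⇔_)

-- Alphabet {0,1}: false = 0, true = 1.
Word : Set
Word = List Bool

Language : Set₁
Language = Word → Set

record DFA (n : ℕ) : Set where
  field
    δ      : Fin n → Bool → Fin n
    start  : Fin n
    final  : Fin n → Bool

  run : Fin n → Word → Fin n
  run q []       = q
  run q (a ∷ w)  = run (δ q a) w

  accepts : Word → Bool
  accepts w = final (run start w)

Recognizes : ∀ {n} → DFA n → Language → Set
Recognizes D L = ∀ w → (DFA.accepts D w ≡ true) ⇔ L w

data Star (S : List Word) : Language where
  ε∈ : Star S []
  cat∈ : ∀ {u v} → u ∈ S → Star S v → Star S (u ++ v)

totalLength : List Word → ℕ
totalLength S = sum (map length S)

-- For t = k + 3, S t consists of the words 0^a 1 0^b with (a , b) one of (1 , k+1), (0 , k+1),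
-- (0 , 0) and (3 + j , k - j) for j ≤ k. Each has a single 1, so while a word is being factored
-- the only relevant information is the number d of 0s still owed to the last factor (Owes d).
-- Write c ∈ {0,1}^m after the prefix 01 as blocks 0^(k+1) 1 for a 1 and (0^(k+2) 1)^2 for a 0.
-- The debt k + 1 survives every letter and on a 1 also spawns the debt 0, while a debt d ≤ k - 2
-- grows by exactly 2 per letter. Hence, when 2m ≤ k, the suffixes 0^v completing the prefix of c
-- to a word of S_t^* are v = k + 1 and v = 2i for each 1 of c followed by i letters (Marked c).
-- This set determines c, so the 2^m prefixes lie in distinct Nerode classes: sc(S_t^*) ≥ 2^⌊k/2⌋.
module Submission where

open import Defs
open import Data.Bool using (Bool; true; false)
open import Data.Nat using (ℕ; zero; suc; _+_; _*_; _^_; _∸_; _≤_; _<_; z≤n; s≤s; _≤?_; ⌊_/2⌋)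
open import Data.Nat.Properties
open import Algebra.Properties.CommutativeSemigroup +-commutativeSemigroup using (x∙yz≈y∙xz)
open import Data.Nat.Tactic.RingSolver using (solve-∀)
open import Data.Nat.ListAction using (sum)
open import Data.Fin using (Fin; zero; suc; remQuot; combine)
open import Data.Fin.Properties using (combine-remQuot; injective⇒≤)
open import Data.Vec using (Vec; []; _∷_)
import Data.Vec.Properties as Vec
open import Data.List using (List; []; _∷_; _++_; length; replicate; map; applyUpTo)
open import Data.List.Properties
  using (∷-injectiveʳ; ++-assoc; ++-identityʳ; length-++; length-map; length-replicate; length-applyUpTo)
open import Data.List.Membership.Propositional using (_∈_; _∉_)
open import Data.List.Membership.Propositional.Properties
  using (∈-map⁺; ∈-map⁻; ∈-applyUpTo⁺; ∈-applyUpTo⁻; ∈-++⁺ˡ; ∈-++⁺ʳ)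
open import Data.List.Relation.Unary.Any using (here; there)
open import Data.List.Relation.Unary.All using (All; []; _∷_)
import Data.List.Relation.Unary.All.Properties as All
open import Data.List.Relation.Unary.AllPairs using ([]; _∷_)
open import Data.List.Relation.Unary.Unique.Propositional using (Unique)
import Data.List.Relation.Unary.Unique.Propositional.Properties as Unique
open import Data.Product using (Σ; ∃; ∃-syntax; _×_; _,_; proj₁; proj₂; uncurry)
open import Data.Sum using (_⊎_; inj₁; inj₂; map₂)
open import Data.Empty using (⊥; ⊥-elim)
open import Function using (_∘_; id)
open import Function.Bundles using (_⇔_; mk⇔; Equivalence)
open import Relation.Binary.PropositionalEquality
open import Relation.Unary using (_⊆_)
open import Relation.Nullary using (yes; no)

run-++ : ∀ {n} (D : DFA n) q u v → DFA.run D q (u ++ v) ≡ DFA.run D (DFA.run D q u) v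
run-++ D q []      v = refl
run-++ D q (a ∷ u) v = run-++ D (DFA.δ D q a) u v

NerodeEquivalent : Language → Word → Word → Set
NerodeEquivalent L u u′ = ∀ z → L (u ++ z) ⇔ L (u′ ++ z)

module _ {n} (D : DFA n) {L : Language} (R : Recognizes D L) where
  open DFA D

  same-state⇒nerode : ∀ {u u′} → run start u ≡ run start u′ → NerodeEquivalent L u u′
  same-state⇒nerode {u} {u′} eq z = mk⇔ (transport same) (transport (sym same))
    where
    same : accepts (u ++ z) ≡ accepts (u′ ++ z)
    same = begin
      final (run start (u ++ z))      ≡⟨ cong final (run-++ D start u z) ⟩
      final (run (run start u) z)     ≡⟨ cong (λ q → final (run q z)) eq ⟩
      final (run (run start u′) z)    ≡⟨ cong final (run-++ D start u′ z) ⟨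
      final (run start (u′ ++ z))     ∎
      where open ≡-Reasoning
    transport : ∀ {w w′} → accepts w ≡ accepts w′ → L w → L w′
    transport {w} {w′} eq′ p = Equivalence.to (R w′) (trans (sym eq′) (Equivalence.from (R w) p))

  inequivalent⇒≤ : ∀ {N} (u : Fin N → Word) →
    (∀ {i j} → NerodeEquivalent L (u i) (u j) → i ≡ j) → N ≤ n
  inequivalent⇒≤ u sep = injective⇒≤ {f = λ i → run start (u i)} (sep ∘ same-state⇒nerode)

bit : Fin 2 → Bool
bit zero       = false
bit (suc zero) = true

bit-injective : ∀ {x y} → bit x ≡ bit y → x ≡ y
bit-injective {zero}     {zero}     _ = refl
bit-injective {suc zero} {suc zero} _ = refl
bit-injective {zero}     {suc zero} ()
bit-injective {suc zero} {zero}     ()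

bits : ∀ m → Fin (2 ^ m) → Vec Bool m
bits zero    _ = []
bits (suc m) i = bit (proj₁ (remQuot {2} (2 ^ m) i)) ∷ bits m (proj₂ (remQuot {2} (2 ^ m) i))

bits-injective : ∀ m {i j} → bits m i ≡ bits m j → i ≡ j
bits-injective zero    {zero} {zero} _ = refl
bits-injective (suc m) {i}    {j}    eq = begin
  i                                        ≡⟨ combine-remQuot {2} (2 ^ m) i ⟨
  uncurry combine (remQuot {2} (2 ^ m) i)  ≡⟨ cong (uncurry combine) remQuot-≡ ⟩
  uncurry combine (remQuot {2} (2 ^ m) j)  ≡⟨ combine-remQuot {2} (2 ^ m) j ⟩
  j                                        ∎
  where
  open ≡-Reasoning
  remQuot-≡ : remQuot {2} (2 ^ m) i ≡ remQuot {2} (2 ^ m) j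
  remQuot-≡ = cong₂ _,_ (bit-injective (Vec.∷-injectiveˡ eq)) (bits-injective m (Vec.∷-injectiveʳ eq))

zeros : ℕ → Word
zeros n = replicate n false

block : ℕ → ℕ → Word
block a b = zeros a ++ true ∷ zeros b

zeros-injective : ∀ {a b} → zeros a ≡ zeros b → a ≡ b
zeros-injective {a} {b} eq = trans (sym (length-replicate a)) (trans (cong length eq) (length-replicate b))

zeros-+ : ∀ d a w → zeros (d + a) ++ w ≡ zeros d ++ zeros a ++ w
zeros-+ zero    a w = refl
zeros-+ (suc d) a w = cong (false ∷_) (zeros-+ d a w)

true∉zeros : ∀ {n} → true ∉ zeros n
true∉zeros {suc n} (there p) = true∉zeros p

zeros++true-injective : ∀ a a′ {x y} → zeros a ++ true ∷ x ≡ zeros a′ ++ true ∷ y → a ≡ a′ × x ≡ y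
zeros++true-injective zero    zero     refl = refl , refl
zeros++true-injective (suc a) (suc a′) eq   with zeros++true-injective a a′ (∷-injectiveʳ eq)
... | refl , x≡y = refl , x≡y

block-injective : ∀ {a b a′ b′} → block a b ≡ block a′ b′ → a ≡ a′ × b ≡ b′
block-injective {a} {b} {a′} {b′} eq with zeros++true-injective a a′ eq
... | a≡a′ , zeros-≡ = a≡a′ , zeros-injective zeros-≡

length-block : ∀ a b → length (block a b) ≡ a + suc b
length-block a b = trans (length-++ (zeros a)) (cong₂ _+_ (length-replicate a) (cong suc (length-replicate b)))

zeros-prefix : ∀ d h {w v} → zeros h ++ true ∷ w ≡ zeros d ++ v →
  ∃ λ a → d + a ≡ h × v ≡ zeros a ++ true ∷ w
zeros-prefix zero    h       eq = h , refl , sym eq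
zeros-prefix (suc d) (suc h) eq with zeros-prefix d h (∷-injectiveʳ eq)
... | a , d+a≡h , v≡ = a , cong suc d+a≡h , v≡

d+[1+m+1+m]≡2+d+[m+m] : ∀ d m → d + (suc m + suc m) ≡ 2 + d + (m + m)
d+[1+m+1+m]≡2+d+[m+m] = solve-∀

m+m<1+m+1+m : ∀ m → m + m < suc m + suc m
m+m<1+m+1+m m = s≤s (+-monoʳ-≤ m (n≤1+n m))

Marked : ∀ {m} → Vec Bool m → ℕ → Set
Marked []                 v = ⊥
Marked {suc m} (true ∷ c) v = v ≡ m + m ⊎ Marked c v
Marked (false ∷ c)        v = Marked c v

marked-∷ : ∀ {m} x (c : Vec Bool m) → Marked c ⊆ Marked (x ∷ c)
marked-∷ true  c = inj₂
marked-∷ false c = id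

marked-< : ∀ {m v} (c : Vec Bool m) → Marked c v → v < m + m
marked-< {suc m} (true ∷ c)  (inj₁ refl) = m+m<1+m+1+m m
marked-< {suc m} (true ∷ c)  (inj₂ p)    = <-trans (marked-< c p) (m+m<1+m+1+m m)
marked-< {suc m} (false ∷ c) p           = <-trans (marked-< c p) (m+m<1+m+1+m m)

marked-tail : ∀ {m} (c c′ : Vec Bool m) → Marked (true ∷ c) ⊆ Marked (true ∷ c′) → Marked c ⊆ Marked c′
marked-tail c c′ c⊆c′ p with c⊆c′ (inj₂ p)
... | inj₁ refl = ⊥-elim (<-irrefl refl (marked-< c p))
... | inj₂ q     = q

marked-injective : ∀ {m} (c c′ : Vec Bool m) → Marked c ⊆ Marked c′ → Marked c′ ⊆ Marked c → c ≡ c′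
marked-injective []          []           _    _    = refl
marked-injective (true ∷ c)  (true ∷ c′)  c⊆c′ c′⊆c =
  cong (true ∷_) (marked-injective c c′ (marked-tail c c′ c⊆c′) (marked-tail c′ c c′⊆c))
marked-injective (true ∷ c)  (false ∷ c′) c⊆c′ _    = ⊥-elim (<-irrefl refl (marked-< c′ (c⊆c′ (inj₁ refl))))
marked-injective (false ∷ c) (true ∷ c′)  _    c′⊆c = ⊥-elim (<-irrefl refl (marked-< c (c′⊆c (inj₁ refl))))
marked-injective (false ∷ c) (false ∷ c′) c⊆c′ c′⊆c =
  cong (false ∷_) (marked-injective c c′ c⊆c′ c′⊆c)

module Family (k : ℕ) where

  data Shape : ℕ → ℕ → Set where
    regular : ∀ j b → j + b ≡ k → Shape (3 + j) b
    carry   : Shape 1 (suc k)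
    keep    : Shape 0 (suc k)
    emit    : Shape 0 0

  regularShape : ℕ → ℕ × ℕ
  regularShape j = 3 + j , k ∸ j

  shapes : List (ℕ × ℕ)
  shapes = (1 , suc k) ∷ (0 , suc k) ∷ (0 , 0) ∷ applyUpTo regularShape (suc k)

  family : List Word
  family = map (uncurry block) shapes

  ∈-shapes⁻ : ∀ {a b} → (a , b) ∈ shapes → Shape a b
  ∈-shapes⁻ (here refl)                 = carry
  ∈-shapes⁻ (there (here refl))         = keep
  ∈-shapes⁻ (there (there (here refl))) = emit
  ∈-shapes⁻ (there (there (there p))) with ∈-applyUpTo⁻ regularShape p
  ... | j , s≤s j≤k , refl = regular j (k ∸ j) (m+[n∸m]≡n j≤k)

  ∈-shapes⁺ : ∀ {a b} → Shape a b → (a , b) ∈ shapes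
  ∈-shapes⁺ carry = here refl
  ∈-shapes⁺ keep  = there (here refl)
  ∈-shapes⁺ emit  = there (there (here refl))
  ∈-shapes⁺ (regular j b j+b≡k) = there (there (there
    (subst (λ b′ → (3 + j , b′) ∈ applyUpTo regularShape (suc k)) k∸j≡b
      (∈-applyUpTo⁺ regularShape (s≤s j≤k)))))
    where
    j≤k : j ≤ k
    j≤k = subst (j ≤_) j+b≡k (m≤m+n j b)
    k∸j≡b : k ∸ j ≡ b
    k∸j≡b = trans (cong (_∸ j) (sym j+b≡k)) (m+n∸m≡n j b)

  ∈-family⁻ : ∀ {u} → u ∈ family → ∃[ a ] ∃[ b ] Shape a b × u ≡ block a b
  ∈-family⁻ p with ∈-map⁻ (uncurry block) p
  ... | (a , b) , ab∈ , eq = a , b , ∈-shapes⁻ ab∈ , eq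

  ∈-family⁺ : ∀ {a b} → Shape a b → block a b ∈ family
  ∈-family⁺ shape = ∈-map⁺ (uncurry block) (∈-shapes⁺ shape)

  Owes : ℕ → Word → Set
  Owes d w = ∃ λ v → w ≡ zeros d ++ v × Star family v

  owes-zeros⁺ : ∀ d → Owes d (zeros d)
  owes-zeros⁺ d = [] , sym (++-identityʳ (zeros d)) , ε∈

  owes-zeros⁻ : ∀ {d v} → Owes d (zeros v) → v ≡ d
  owes-zeros⁻ {d} (_ , eq , ε∈) = zeros-injective (trans eq (++-identityʳ (zeros d)))
  owes-zeros⁻ {d} (_ , eq , cat∈ {u} {v} u∈ _) with ∈-family⁻ u∈
  ... | a , b , _ , refl = ⊥-elim (true∉zeros (subst (true ∈_) (sym eq)
    (∈-++⁺ʳ (zeros d) (∈-++⁺ˡ (∈-++⁺ʳ (zeros a) (here refl))))))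

  star-block⁻ : ∀ {a w x} → Star family x → x ≡ zeros a ++ true ∷ w → ∃ λ b → Shape a b × Owes b w
  star-block⁻ {zero}  ε∈ ()
  star-block⁻ {suc a} ε∈ ()
  star-block⁻ {a} {w} (cat∈ {u} {v} u∈ st) eq with ∈-family⁻ u∈
  ... | a′ , b , shape , refl
    with zeros++true-injective a′ a (trans (sym (++-assoc (zeros a′) (true ∷ zeros b) v)) eq)
  ... | refl , rest = b , shape , v , sym rest , st

  star-block⁺ : ∀ {a b w} → Shape a b → Owes b w → Star family (zeros a ++ true ∷ w)
  star-block⁺ {a} {b} shape (v , refl , st) =
    subst (Star family) (++-assoc (zeros a) (true ∷ zeros b) v) (cat∈ (∈-family⁺ shape) st)

  -- Reading 0^h 1 with d zeros owed can leave b zeros owed.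
  Step : ℕ → ℕ → ℕ → Set
  Step h d b = ∃ λ a → d + a ≡ h × Shape a b

  owes-block⁻ : ∀ {h d w} → Owes d (zeros h ++ true ∷ w) → ∃ λ b → Step h d b × Owes b w
  owes-block⁻ {h} {d} (v , eq , st) with zeros-prefix d h eq
  ... | a , d+a≡h , v≡ with star-block⁻ st v≡
  ... | b , shape , owes = b , (a , d+a≡h , shape) , owes

  owes-block⁺ : ∀ {h d b w} → Step h d b → Owes b w → Owes d (zeros h ++ true ∷ w)
  owes-block⁺ {d = d} {w = w} (a , refl , shape) owes =
    zeros a ++ true ∷ w , zeros-+ d a (true ∷ w) , star-block⁺ shape owes

  step-source⁻ : ∀ s {b} → Step (s + suc k) (suc k) b → Shape s b
  step-source⁻ s {b} (a , eq , shape) = subst (λ a′ → Shape a′ b) a≡s shape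
    where
    a≡s : a ≡ s
    a≡s = +-cancelˡ-≡ (suc k) a s (trans eq (+-comm s (suc k)))

  step-source⁺ : ∀ {s b} → Shape s b → Step (s + suc k) (suc k) b
  step-source⁺ {s} shape = s , +-comm (suc k) s , shape

  prefix-too-short : ∀ s {a d} → a ≤ 1 → d + a ≡ s + suc k → 2 + d ≤ s + k → ⊥
  prefix-too-short s {a} {d} a≤1 eq le = <⇒≱ s+1+k<s+k (+-monoʳ-≤ s (n≤1+n k))
    where
    open ≤-Reasoning
    s+1+k<s+k : s + suc k < s + k
    s+1+k<s+k = begin-strict
      s + suc k ≡⟨ eq ⟨
      d + a     ≤⟨ +-monoʳ-≤ d a≤1 ⟩
      d + 1     ≡⟨ +-comm d 1 ⟩
      suc d     <⟨ n<1+n (suc d) ⟩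
      2 + d     ≤⟨ le ⟩
      s + k     ∎

  step-regular⁻ : ∀ s {d b} → 2 + d ≤ s + k → Step (s + suc k) d b → s + b ≡ 2 + d
  step-regular⁻ s {d} {b} le (_ , eq , regular j b j+b≡k) =
    +-cancelˡ-≡ j (s + b) (2 + d) (suc-injective (begin
      suc (j + (s + b)) ≡⟨ cong suc (x∙yz≈y∙xz j s b) ⟩
      suc (s + (j + b)) ≡⟨ cong (λ x → suc (s + x)) j+b≡k ⟩
      suc (s + k)       ≡⟨ +-suc s k ⟨
      s + suc k         ≡⟨ eq ⟨
      d + (3 + j)       ≡⟨ d+[3+j]≡1+j+[2+d] d j ⟩
      suc (j + (2 + d)) ∎))
    where
    open ≡-Reasoning
    d+[3+j]≡1+j+[2+d] : ∀ d j → d + (3 + j) ≡ suc (j + (2 + d))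
    d+[3+j]≡1+j+[2+d] = solve-∀
  step-regular⁻ s le (_ , eq , carry) = ⊥-elim (prefix-too-short s (s≤s z≤n) eq le)
  step-regular⁻ s le (_ , eq , keep)  = ⊥-elim (prefix-too-short s z≤n eq le)
  step-regular⁻ s le (_ , eq , emit)  = ⊥-elim (prefix-too-short s z≤n eq le)

  step-regular⁺ : ∀ s {d b} → 2 + d ≤ s + k → s + b ≡ 2 + d → Step (s + suc k) d b
  step-regular⁺ s {d} {b} le s+b≡2+d with m≤n⇒∃[o]m+o≡n le
  ... | o , 2+d+o≡s+k = 3 + o , d+[3+o]≡s+1+k , regular o b o+b≡k
    where
    open ≡-Reasoning
    d+[3+o]≡1+[2+d+o] : ∀ d o → d + (3 + o) ≡ suc (2 + d + o)
    d+[3+o]≡1+[2+d+o] = solve-∀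
    d+[3+o]≡s+1+k : d + (3 + o) ≡ s + suc k
    d+[3+o]≡s+1+k = begin
      d + (3 + o)     ≡⟨ d+[3+o]≡1+[2+d+o] d o ⟩
      suc (2 + d + o) ≡⟨ cong suc 2+d+o≡s+k ⟩
      suc (s + k)     ≡⟨ +-suc s k ⟨
      s + suc k       ∎
    o+b≡k : o + b ≡ k
    o+b≡k = +-cancelˡ-≡ s (o + b) k (begin
      s + (o + b)     ≡⟨ x∙yz≈y∙xz s o b ⟩
      o + (s + b)     ≡⟨ cong (o +_) s+b≡2+d ⟩
      o + (2 + d)     ≡⟨ +-comm o (2 + d) ⟩
      2 + d + o       ≡⟨ 2+d+o≡s+k ⟩
      s + k           ∎)

  encode : ∀ {m} → Vec Bool m → Word → Word
  encode []          w = w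
  encode (true ∷ c)  w = zeros (suc k) ++ true ∷ encode c w
  encode (false ∷ c) w = zeros (2 + k) ++ true ∷ zeros (2 + k) ++ true ∷ encode c w

  owes-letter⁻ : ∀ {m d w} x (c : Vec Bool m) → 2 + d ≤ k →
    Owes d (encode (x ∷ c) w) → Owes (2 + d) (encode c w)
  owes-letter⁻ true c le owes with owes-block⁻ owes
  ... | b , step , owes′ with step-regular⁻ 0 le step
  ... | refl = owes′
  owes-letter⁻ false c le owes with owes-block⁻ owes
  ... | b , step , owes′ with step-regular⁻ 1 (m≤n⇒m≤1+n le) step
  ... | refl with owes-block⁻ owes′
  ... | b′ , step′ , owes″ with step-regular⁻ 1 (s≤s le) step′
  ... | refl = owes″

  owes-letter⁺ : ∀ {m d w} x (c : Vec Bool m) → 2 + d ≤ k →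
    Owes (2 + d) (encode c w) → Owes d (encode (x ∷ c) w)
  owes-letter⁺ true  c le owes = owes-block⁺ (step-regular⁺ 0 le refl) owes
  owes-letter⁺ false c le owes =
    owes-block⁺ (step-regular⁺ 1 (m≤n⇒m≤1+n le) refl) (owes-block⁺ (step-regular⁺ 1 (s≤s le) refl) owes)

  owes-source-letter⁻ : ∀ {m w} x (c : Vec Bool m) → Owes (suc k) (encode (x ∷ c) w) →
    Owes (suc k) (encode c w) ⊎ (x ≡ true × Owes 0 (encode c w))
  owes-source-letter⁻ true c owes with owes-block⁻ owes
  ... | b , step , owes′ with step-source⁻ 0 step
  ... | keep = inj₁ owes′
  ... | emit = inj₂ (refl , owes′)
  owes-source-letter⁻ false c owes with owes-block⁻ owes
  ... | b , step , owes′ with step-source⁻ 1 step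
  ... | carry with owes-block⁻ owes′
  ... | b′ , step′ , owes″ with step-source⁻ 1 step′
  ... | carry = inj₁ owes″

  owes-source-letter⁺ : ∀ {m w} x (c : Vec Bool m) → Owes (suc k) (encode c w) → Owes (suc k) (encode (x ∷ c) w)
  owes-source-letter⁺ true  c owes = owes-block⁺ (step-source⁺ keep) owes
  owes-source-letter⁺ false c owes = owes-block⁺ (step-source⁺ carry) (owes-block⁺ (step-source⁺ carry) owes)

  owes-source-emit : ∀ {m w} (c : Vec Bool m) → Owes 0 (encode c w) → Owes (suc k) (encode (true ∷ c) w)
  owes-source-emit c owes = owes-block⁺ (step-source⁺ emit) owes

  owes-regular⁻ : ∀ {m d v} (c : Vec Bool m) → d + (m + m) ≤ k → Owes d (encode c (zeros v)) → v ≡ d + (m + m)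
  owes-regular⁻ {d = d} [] le owes = trans (owes-zeros⁻ owes) (sym (+-identityʳ d))
  owes-regular⁻ {suc m} {d} (x ∷ c) le owes =
    trans (owes-regular⁻ c le′ (owes-letter⁻ x c (≤-trans (m≤m+n (2 + d) (m + m)) le′) owes))
          (sym (d+[1+m+1+m]≡2+d+[m+m] d m))
    where
    le′ : 2 + d + (m + m) ≤ k
    le′ = subst (_≤ k) (d+[1+m+1+m]≡2+d+[m+m] d m) le

  owes-regular⁺ : ∀ {m} d (c : Vec Bool m) → d + (m + m) ≤ k → Owes d (encode c (zeros (d + (m + m))))
  owes-regular⁺ d [] le = subst (Owes d ∘ zeros) (sym (+-identityʳ d)) (owes-zeros⁺ d)
  owes-regular⁺ {suc m} d (x ∷ c) le =
    owes-letter⁺ x c (≤-trans (m≤m+n (2 + d) (m + m)) le′)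
      (subst (Owes (2 + d) ∘ encode c ∘ zeros) (sym (d+[1+m+1+m]≡2+d+[m+m] d m)) (owes-regular⁺ (2 + d) c le′))
    where
    le′ : 2 + d + (m + m) ≤ k
    le′ = subst (_≤ k) (d+[1+m+1+m]≡2+d+[m+m] d m) le

  tail-fits : ∀ {m} → suc m + suc m ≤ k → m + m ≤ k
  tail-fits {m} le = ≤-trans (<⇒≤ (m+m<1+m+1+m m)) le

  owes-source⁻ : ∀ {m v} (c : Vec Bool m) → m + m ≤ k →
    Owes (suc k) (encode c (zeros v)) → v ≡ suc k ⊎ Marked c v
  owes-source⁻ [] le owes = inj₁ (owes-zeros⁻ owes)
  owes-source⁻ {suc m} (x ∷ c) le owes with owes-source-letter⁻ x c owes
  ... | inj₁ owes′         = map₂ (marked-∷ x c) (owes-source⁻ c (tail-fits le) owes′)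
  ... | inj₂ (refl , owes′) = inj₂ (inj₁ (owes-regular⁻ c (tail-fits le) owes′))

  owes-source⁺ : ∀ {m v} (c : Vec Bool m) → m + m ≤ k → Marked c v → Owes (suc k) (encode c (zeros v))
  owes-source⁺ {suc m} (true ∷ c) le (inj₁ refl) = owes-source-emit c (owes-regular⁺ 0 c (tail-fits le))
  owes-source⁺ {suc m} (true ∷ c) le (inj₂ p)    = owes-source-letter⁺ true c (owes-source⁺ c (tail-fits le) p)
  owes-source⁺ {suc m} (false ∷ c) le p          = owes-source-letter⁺ false c (owes-source⁺ c (tail-fits le) p)

  prefix : ∀ {m} → Vec Bool m → Word
  prefix c = false ∷ true ∷ encode c []

  prefix-++ : ∀ {m} (c : Vec Bool m) z → prefix c ++ z ≡ false ∷ true ∷ encode c z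
  prefix-++ c z = cong (λ w → false ∷ true ∷ w) (encode-++ c z)
    where
    encode-++ : ∀ {m} (c : Vec Bool m) z → encode c [] ++ z ≡ encode c z
    encode-++ []          z = refl
    encode-++ (true ∷ c)  z =
      trans (++-assoc (zeros (suc k)) _ z) (cong (λ w → zeros (suc k) ++ true ∷ w) (encode-++ c z))
    encode-++ (false ∷ c) z = trans (++-assoc (zeros (2 + k)) _ z) (cong (λ w → zeros (2 + k) ++ true ∷ w)
      (trans (++-assoc (zeros (2 + k)) _ z) (cong (λ w → zeros (2 + k) ++ true ∷ w) (encode-++ c z))))

  star-prefix⁻ : ∀ {m v} (c : Vec Bool m) → m + m ≤ k →
    Star family (prefix c ++ zeros v) → v ≡ suc k ⊎ Marked c v
  star-prefix⁻ {v = v} c le st with star-block⁻ {1} st (prefix-++ c (zeros v))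
  ... | _ , carry , owes = owes-source⁻ c le owes

  star-prefix⁺ : ∀ {m v} (c : Vec Bool m) → m + m ≤ k → Marked c v → Star family (prefix c ++ zeros v)
  star-prefix⁺ {v = v} c le p =
    subst (Star family) (sym (prefix-++ c (zeros v))) (star-block⁺ carry (owes-source⁺ c le p))

  residual-marked : ∀ {m} (c c′ : Vec Bool m) → m + m ≤ k →
    (∀ z → Star family (prefix c ++ z) → Star family (prefix c′ ++ z)) → Marked c ⊆ Marked c′
  residual-marked c c′ le residual {v} p with star-prefix⁻ c′ le (residual (zeros v) (star-prefix⁺ c le p))
  ... | inj₁ refl = ⊥-elim (<⇒≱ (≤-trans (marked-< c p) le) (n≤1+n k))
  ... | inj₂ q    = q

  prefix-classes-distinct : ∀ {m} (c c′ : Vec Bool m) → m + m ≤ k →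
    NerodeEquivalent (Star family) (prefix c) (prefix c′) → c ≡ c′
  prefix-classes-distinct c c′ le equiv = marked-injective c c′
    (residual-marked c c′ le (Equivalence.to ∘ equiv)) (residual-marked c′ c le (Equivalence.from ∘ equiv))

  sc-star-family : ∀ {n} (D : DFA n) → Recognizes D (Star family) → ∀ m → m + m ≤ k → 2 ^ m ≤ n
  sc-star-family D R m le =
    inequivalent⇒≤ D R (prefix ∘ bits m) (bits-injective m ∘ prefix-classes-distinct (bits m _) (bits m _) le)

  length-family : length family ≡ 4 + k
  length-family = trans (length-map (uncurry block) shapes) (cong (3 +_) (length-applyUpTo regularShape (suc k)))

  family-unique : Unique family
  family-unique = Unique.map⁺ uncurry-block-injective shapes-unique
    where
    uncurry-block-injective : ∀ {x y} → uncurry block x ≡ uncurry block y → x ≡ y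
    uncurry-block-injective {_ , _} {_ , _} eq = uncurry (cong₂ _,_) (block-injective eq)
    shapes-unique : Unique shapes
    shapes-unique =
        ((λ ()) ∷ (λ ()) ∷ All.applyUpTo⁺₁ regularShape (suc k) (λ _ ()))
      ∷ ((λ ()) ∷ All.applyUpTo⁺₁ regularShape (suc k) (λ _ ()))
      ∷ All.applyUpTo⁺₁ regularShape (suc k) (λ _ ())
      ∷ Unique.applyUpTo⁺₁ regularShape (suc k)
          (λ i<j _ → <⇒≢ i<j ∘ suc-injective ∘ suc-injective ∘ suc-injective ∘ cong proj₁)

  family-lengths : All (λ w → length w ≤ 4 + k) family
  family-lengths = All.map⁺ {xs = shapes} {f = uncurry block}
    ( fits 1 (suc k) (n≤1+n _) ∷ fits 0 (suc k) (m≤n+m _ 2) ∷ fits 0 0 (s≤s z≤n)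
    ∷ All.applyUpTo⁺₁ regularShape (suc k)
        (λ { {j} (s≤s j≤k) → fits (3 + j) (k ∸ j) (≤-reflexive (regular-length j≤k)) }))
    where
    fits : ∀ a b → a + suc b ≤ 4 + k → length (block a b) ≤ 4 + k
    fits a b = subst (_≤ 4 + k) (sym (length-block a b))
    regular-length : ∀ {j} → j ≤ k → 3 + j + suc (k ∸ j) ≡ 4 + k
    regular-length {j} j≤k = cong (3 +_) (trans (+-suc j (k ∸ j)) (cong suc (m+[n∸m]≡n j≤k)))

-- No bound is claimed for t ≤ 4, and t = 2 only needs three distinct words of length at most 3.
S : ℕ → List Word
S (suc (suc (suc k))) = Family.family k
S _                   = (false ∷ []) ∷ (true ∷ []) ∷ (false ∷ false ∷ []) ∷ []

S-shape : ∀ t → 2 ≤ t → length (S t) ≡ suc t × Unique (S t) × All (λ w → length w ≤ suc t) (S t)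
S-shape 1 (s≤s ())
S-shape 2 _ =
  refl , ((λ ()) ∷ (λ ()) ∷ []) ∷ ((λ ()) ∷ []) ∷ [] ∷ [] , s≤s z≤n ∷ s≤s z≤n ∷ s≤s (s≤s z≤n) ∷ []
S-shape (suc (suc (suc k))) _ = Family.length-family k , Family.family-unique k , Family.family-lengths k

sum-map-length-≤ : ∀ {c} (ws : List Word) → All (λ w → length w ≤ c) ws → sum (map length ws) ≤ length ws * c
sum-map-length-≤ []       []       = z≤n
sum-map-length-≤ (w ∷ ws) (p ∷ ps) = +-mono-≤ p (sum-map-length-≤ ws ps)

totalLength-S : ∀ t → 2 ≤ t → totalLength (S t) ≤ suc t * suc t
totalLength-S t 2≤t with S-shape t 2≤t
... | length≡ , _ , lengths =
  subst (λ l → totalLength (S t) ≤ l * suc t) length≡ (sum-map-length-≤ (S t) lengths)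

m*m≤n*n⇒m≤n : ∀ {m n} → m * m ≤ n * n → m ≤ n
m*m≤n*n⇒m≤n {m} {n} m*m≤n*n with m ≤? n
... | yes m≤n = m≤n
... | no  m≰n = ⊥-elim (<⇒≱ (*-mono-< (≰⇒> m≰n) (≰⇒> m≰n)) m*m≤n*n)

⌊n/2⌋+⌊n/2⌋≤n : ∀ n → ⌊ n /2⌋ + ⌊ n /2⌋ ≤ n
⌊n/2⌋+⌊n/2⌋≤n n = ≤-trans (+-monoʳ-≤ ⌊ n /2⌋ (⌊n/2⌋≤⌈n/2⌉ n)) (≤-reflexive (⌊n/2⌋+⌈n/2⌉≡n n))

4+n≤⌊n/2⌋*7 : ∀ {n} → 2 ≤ n → 4 + n ≤ ⌊ n /2⌋ * 7
4+n≤⌊n/2⌋*7 {1} (s≤s ())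
4+n≤⌊n/2⌋*7 {2} _ = n≤1+n 6
4+n≤⌊n/2⌋*7 {3} _ = ≤-refl
4+n≤⌊n/2⌋*7 {suc (suc n@(suc (suc _)))} _ =
  s≤s (s≤s (≤-trans (4+n≤⌊n/2⌋*7 {n} (s≤s (s≤s z≤n))) (m≤n+m _ 5)))

sc-star-S : ∀ {t n} (D : DFA n) → 5 ≤ t → Recognizes D (Star (S t)) → 2 ^ suc t ≤ n ^ 7
sc-star-S {n = n} D (s≤s (s≤s (s≤s {n = k} 2≤k))) R = begin
  2 ^ (4 + k)         ≤⟨ ^-monoʳ-≤ 2 (4+n≤⌊n/2⌋*7 2≤k) ⟩
  2 ^ (⌊ k /2⌋ * 7)   ≡⟨ ^-*-assoc 2 ⌊ k /2⌋ 7 ⟨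
  (2 ^ ⌊ k /2⌋) ^ 7   ≤⟨ ^-monoˡ-≤ 7 (Family.sc-star-family k D R ⌊ k /2⌋ (⌊n/2⌋+⌊n/2⌋≤n k)) ⟩
  n ^ 7               ∎
  where open ≤-Reasoning

corollary9 : Σ (ℕ → List Word) λ S →
  ((t : ℕ) → 2 ≤ t →
    (length (S t) ≡ suc t) × Unique (S t) × All (λ w → length w ≤ suc t) (S t))
  × (∃[ a ] ∃[ t₀ ] (1 ≤ a × ((t : ℕ) → 2 ≤ t → t₀ ≤ t →
      (n : ℕ) (D : DFA n) → Recognizes D (Star (S t)) → 2 ^ t ≤ n ^ a)))
  × (∃[ a ] ∃[ t₀ ] (1 ≤ a × ((t : ℕ) → 2 ≤ t → t₀ ≤ t →
      (n : ℕ) (D : DFA n) → Recognizes D (Star (S t)) →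
      (k : ℕ) → k * k ≤ totalLength (S t) → 2 ^ k ≤ n ^ a)))
corollary9 =
    S
  , S-shape
  , (7 , 5 , s≤s z≤n , λ t _ 5≤t n D R → ≤-trans (^-monoʳ-≤ 2 (n≤1+n t)) (sc-star-S D 5≤t R))
  , (7 , 5 , s≤s z≤n , λ t 2≤t 5≤t n D R k k*k≤ →
      let k≤1+t = m*m≤n*n⇒m≤n {k} {suc t} (≤-trans k*k≤ (totalLength-S t 2≤t))
      in  ≤-trans (^-monoʳ-≤ 2 k≤1+t) (sc-star-S D 5≤t R))
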